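{- Let $n\geq 3$, $\mathfrak{d}_n=\sum_{k=1}^{n-1}X_k$, and define $\Pi_n:\mathcal{S}_n\to\mathbb{R}[X_1,\dots,X_{n-1}]$ by $\Pi_n(\tau)=\sum_{\sigma\in\mathcal{S}_n}\mathtt{des_X}(\tau\sigma)\,\mathtt{des_X}(\sigma^{ -1})$. Then for every $\tau\in\mathcal{S}_n$, $$\Pi_n(\tau)=\Pi_n(\iota)-\mathtt{des_X}(\tau)\,(n-2)!\,\mathfrak{d}_n,$$ where $\iota$ is the identity permutation.
   Context: $\mathcal{S}_n$ is the symmetric group on $[n]$ with product given by composition, $(\tau\sigma)(k)=\tau(\sigma(k))$; $\mathtt{des_X}(\sigma)=\sum_{k\in[n-1],\,\sigma(k)>\sigma(k+1)}X_k$. -}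

module Defs where

open import Level using (Level)
open import Data.Nat using (ℕ; zero; suc)
open import Data.Fin using (Fin; zero; suc; inject₁; _<?_)
open import Data.List using (List; []; _∷_; map; concatMap; foldr)
open import Data.List.Base using (allFin)
open import Data.Fin.Permutation using (Permutation′; id; insert; _⟨$⟩ʳ_; _⟨$⟩ˡ_)
open import Relation.Nullary.Decidable using (does)
open import Data.Bool using (if_then_else_)
open import Algebra.Bundles using (CommutativeRing)

-- The list of all permutations of Fin n (each element of S_n occurs exactly once):
-- a permutation of Fin (suc n) is determined by the image j of 0 and the
-- induced permutation of the remaining points ('insert 0 j π').
allPerms : (n : ℕ) → List (Permutation′ n)
allPerms zero    = id ∷ []
allPerms (suc n) = concatMap (λ j → map (insert zero j) (allPerms n)) (allFin (suc n))

module _ {c ℓ : Level} (R : CommutativeRing c ℓ) where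
  open CommutativeRing R using (Carrier; _+_; _*_; 0#; 1#)

  sumFin : (m : ℕ) → (Fin m → Carrier) → Carrier
  sumFin zero    f = 0#
  sumFin (suc m) f = f zero + sumFin m (λ k → f (suc k))

  sumList : {A : Set} → List A → (A → Carrier) → Carrier
  sumList xs f = foldr (λ a s → f a + s) 0# xs

  natR : ℕ → Carrier
  natR zero    = 0#
  natR (suc k) = 1# + natR k

  -- des_X of a map f : [n] → [n] with n = suc m, evaluated at X = x, where
  -- x k (k : Fin m, 0-based) is X_{k+1}; positions k+1, k+2 are inject₁ k, suc k.
  desX : {m : ℕ} → (x : Fin m → Carrier) → (Fin (suc m) → Fin (suc m)) → Carrier
  desX {m} x f = sumFin m (λ k → if does (f (suc k) <? f (inject₁ k)) then x k else 0#)

  dn : {m : ℕ} → (x : Fin m → Carrier) → Carrier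
  dn {m} x = sumFin m x

  Pi : {m : ℕ} → (x : Fin m → Carrier) → Permutation′ (suc m) → Carrier
  Pi {m} x τ = sumList (allPerms (suc m))
    (λ σ → desX x (λ k → τ ⟨$⟩ʳ (σ ⟨$⟩ʳ k)) * desX x (λ k → σ ⟨$⟩ˡ k))

module Submission where

-- Write Π_n(τ) = Σ_σ des_X(τσ) des_X(σ⁻¹) as a quadratic form in X: the
-- coefficient of X_{i+1} X_{j+1} is the number N_τ(i,j) of σ ∈ S_n such that τσ
-- has a descent at position i and σ⁻¹ has a descent at position j.  The theorem
-- is the coefficientwise identity (n = k + 2)
--     N_τ(i,j) + [τ has a descent at j] · k!  =  N_ι(i,j).
-- Pair σ with σ∘(i i+1).  Exactly one member of a pair has a descent at i, and
-- the same holds for τσ, so both sides count one element per pair, namely the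
-- σ⁻¹-descents at j.  Swapping the entries at i, i+1 of σ changes whether σ⁻¹
-- has a descent at j only when σ maps positions {i, i+1} onto the values
-- {j, j+1}; the pairs with σ(i) = j, σ(i+1) = j+1 (there are k! of them)
-- account for the correction term [τ has a descent at j] · k!.

open import Defs
open import Level using (Level)
open import Data.Nat as ℕ using (ℕ; zero; suc; _≤_; _∸_; s≤s; _!)
import Data.Nat.Properties as ℕₚ
open import Data.Fin using (Fin; zero; suc; inject₁; toℕ; punchIn; punchOut; _<_; _<?_)
open import Data.Fin.Properties
  using (_≟_; all?; suc-injective; punchIn-injective; punchInᵢ≢i; punchIn-punchOut;
         toℕ-inject₁; <-irrefl; <-asym; <-trans; <-cmp; ≤∧≢⇒<)
import Data.Fin.Permutation.Components as PC
open import Data.Fin.Permutation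
  using (Permutation′; id; flip; transpose; insert; remove; _∘ₚ_; _⟨$⟩ʳ_; _⟨$⟩ˡ_;
         inverseˡ; inverseʳ; insert-punchIn; insert-remove; punchIn-permute)
  renaming (_≈_ to _≈ₚ_)
open import Data.List using (List; []; _∷_; map; concatMap; _++_; allFin; tabulate)
open import Data.Bool using (Bool; true; false; not; if_then_else_)
open import Data.Product using (_×_; _,_)
open import Data.Empty using (⊥-elim)
open import Relation.Nullary using (Dec; yes; no; does; ¬_)
open import Relation.Nullary.Decidable using (dec-true; dec-false; does-⇔; _×-dec_)
open import Relation.Binary.PropositionalEquality as ≡ using (_≡_; _≢_; refl)
open import Function using (_∘_; _⇔_; mk⇔)
open import Function.Construct.Identity using (⇔-id)
open import Function.Construct.Symmetry using (⇔-sym)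
open import Function.Construct.Composition using (_⇔-∘_)
open import Data.Product.Function.NonDependent.Propositional using (_×-⇔_)
open import Relation.Binary.Definitions using (tri<; tri≈; tri>)
open import Algebra.Bundles using (CommutativeRing)

-- S_n acts on Fin n; σ ∘ₚ τ is "first σ, then τ", i.e. the product τσ.
Perm : ℕ → Set
Perm = Permutation′

-- Every permutation of Fin (suc n) is 'insert zero j π' for j its value at 0.
ins : ∀ {n} → Fin (suc n) → Perm n → Perm (suc n)
ins j π = insert zero j π

ins-suc : ∀ {n} (j : Fin (suc n)) (π : Perm n) k → ins j π ⟨$⟩ʳ suc k ≡ punchIn j (π ⟨$⟩ʳ k)
ins-suc j π = insert-punchIn zero j π

ins-cong : ∀ {n} (j : Fin (suc n)) {π ρ : Perm n} → π ≈ₚ ρ → ins j π ≈ₚ ins j ρ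
ins-cong j e zero = refl
ins-cong j {π} {ρ} e (suc k) =
  ≡.trans (ins-suc j π k) (≡.trans (≡.cong (punchIn j) (e k)) (≡.sym (ins-suc j ρ k)))

ins-≈ₚ : ∀ {n} (j : Fin (suc n)) (π : Perm n) (u : Perm (suc n)) →
  ins j π ≈ₚ u ⇔ (j ≡ u ⟨$⟩ʳ zero × π ≈ₚ remove zero u)
ins-≈ₚ j π u = mk⇔ to from
  where
  to : ins j π ≈ₚ u → j ≡ u ⟨$⟩ʳ zero × π ≈ₚ remove zero u
  to e = e zero , λ k → punchIn-injective j _ _
    (≡.trans (≡.sym (ins-suc j π k)) (≡.trans (e (suc k))
      (≡.trans (punchIn-permute u zero k)
        (≡.cong (λ z → punchIn z (remove zero u ⟨$⟩ʳ k)) (≡.sym (e zero))))))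
  from : j ≡ u ⟨$⟩ʳ zero × π ≈ₚ remove zero u → ins j π ≈ₚ u
  from (refl , e) k = ≡.trans (ins-cong j e k) (insert-remove zero u k)

_≈ₚ?_ : ∀ {n} (σ τ : Perm n) → Dec (σ ≈ₚ τ)
σ ≈ₚ? τ = all? (λ k → σ ⟨$⟩ʳ k ≟ τ ⟨$⟩ʳ k)

sends? : ∀ {n} (σ : Perm n) (p a q b : Fin n) → Dec (σ ⟨$⟩ʳ p ≡ a × σ ⟨$⟩ʳ q ≡ b)
sends? σ p a q b = (σ ⟨$⟩ʳ p ≟ a) ×-dec (σ ⟨$⟩ʳ q ≟ b)

⟨$⟩ˡ-of : ∀ {n} (σ : Perm n) {x y} → σ ⟨$⟩ʳ x ≡ y → σ ⟨$⟩ˡ y ≡ x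
⟨$⟩ˡ-of σ e = ≡.trans (≡.cong (σ ⟨$⟩ˡ_) (≡.sym e)) (inverseˡ σ)

⟨$⟩ʳ-of : ∀ {n} (σ : Perm n) {x y} → σ ⟨$⟩ˡ y ≡ x → σ ⟨$⟩ʳ x ≡ y
⟨$⟩ʳ-of σ e = ≡.trans (≡.cong (σ ⟨$⟩ʳ_) (≡.sym e)) (inverseʳ σ)

⟨$⟩ʳ-injective : ∀ {n} (σ : Perm n) {x y} → σ ⟨$⟩ʳ x ≡ σ ⟨$⟩ʳ y → x ≡ y
⟨$⟩ʳ-injective σ e = ≡.trans (≡.sym (inverseˡ σ)) (⟨$⟩ˡ-of σ (≡.sym e))

⟨$⟩ˡ-cong : ∀ {n} {σ τ : Perm n} → σ ≈ₚ τ → ∀ k → σ ⟨$⟩ˡ k ≡ τ ⟨$⟩ˡ k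
⟨$⟩ˡ-cong {σ = σ} {τ} e k = ≡.sym (⟨$⟩ˡ-of τ (≡.trans (≡.sym (e (σ ⟨$⟩ˡ k))) (inverseʳ σ)))

⟨$⟩ʳ-≡⇔ : ∀ {n} (σ : Perm n) {x z : Fin n} {y : Fin n} → σ ⟨$⟩ʳ z ≡ y → (σ ⟨$⟩ʳ x ≡ y ⇔ x ≡ z)
⟨$⟩ʳ-≡⇔ σ refl = mk⇔ (⟨$⟩ʳ-injective σ) (≡.cong (σ ⟨$⟩ʳ_))

transpose-left : ∀ {n} (i j : Fin n) → PC.transpose i j i ≡ j
transpose-left i j with i ≟ i
... | yes _ = refl
... | no i≢i = ⊥-elim (i≢i refl)

transpose-right : ∀ {n} (i j : Fin n) → PC.transpose i j j ≡ i
transpose-right i j with j ≟ i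
... | yes j≡i = j≡i
... | no _ with j ≟ j
...   | yes _ = refl
...   | no j≢j = ⊥-elim (j≢j refl)

transpose-other : ∀ {n} (i j k : Fin n) → k ≢ i → k ≢ j → PC.transpose i j k ≡ k
transpose-other i j k k≢i k≢j with k ≟ i
... | yes k≡i = ⊥-elim (k≢i k≡i)
... | no _ with k ≟ j
...   | yes k≡j = ⊥-elim (k≢j k≡j)
...   | no _ = refl

descent : ∀ {m} → Perm (suc m) → Fin m → Bool
descent π i = does (π ⟨$⟩ʳ suc i <? π ⟨$⟩ʳ inject₁ i)

descent-cong : ∀ {m} (π ρ : Perm (suc m)) → π ≈ₚ ρ → ∀ i → descent π i ≡ descent ρ i
descent-cong π ρ e i = ≡.cong₂ (λ x y → does (x <? y)) (e (suc i)) (e (inject₁ i))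

<?-flip : ∀ {n} (x y : Fin n) → x ≢ y → does (x <? y) ≡ not (does (y <? x))
<?-flip x y x≢y with <-cmp x y
... | tri< x<y _ y≮x = ≡.trans (dec-true (x <? y) x<y) (≡.cong not (≡.sym (dec-false (y <? x) y≮x)))
... | tri≈ _ x≡y _ = ⊥-elim (x≢y x≡y)
... | tri> x≮y _ y<x = ≡.trans (dec-false (x <? y) x≮y) (≡.cong not (≡.sym (dec-true (y <? x) y<x)))

module Adjacent {m : ℕ} (i : Fin m) where

  a a′ : Fin (suc m)
  a = inject₁ i
  a′ = suc i

  a<a′ : a < a′
  a<a′ = ≡.subst (ℕ._< suc (toℕ i)) (≡.sym (toℕ-inject₁ i)) (ℕₚ.n<1+n (toℕ i))

  a≢a′ : a ≢ a′
  a≢a′ e = <-irrefl e a<a′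

  above : ∀ {z} → z ≢ a′ → a < z ⇔ a′ < z
  above {z} z≢a′ = mk⇔
    (λ a<z → ≤∧≢⇒< (≡.subst (ℕ._≤ toℕ z) (≡.cong suc (toℕ-inject₁ i)) a<z) (z≢a′ ∘ ≡.sym))
    (<-trans a<a′)

  below : ∀ {z} → z ≢ a → z < a ⇔ z < a′
  below {z} z≢a = mk⇔ (λ z<a → <-trans z<a a<a′)
    (λ z<a′ → ≤∧≢⇒< (≡.subst (toℕ z ℕ.≤_) (≡.sym (toℕ-inject₁ i)) (ℕ.s≤s⁻¹ z<a′)) z≢a)

  t : Fin (suc m) → Fin (suc m)
  t = PC.transpose a′ a

  data Place (z : Fin (suc m)) : Set where
    at-a  : z ≡ a → Place z
    at-a′ : z ≡ a′ → Place z
    away  : z ≢ a → z ≢ a′ → Place z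

  place : ∀ z → Place z
  place z with z ≟ a | z ≟ a′
  ... | yes z≡a | _ = at-a z≡a
  ... | no _ | yes z≡a′ = at-a′ z≡a′
  ... | no z≢a | no z≢a′ = away z≢a z≢a′

  compare-images : ∀ {x y x′ y′} → t x ≡ x′ → t y ≡ y′ → (x′ < y′ ⇔ x < y) → (t x < t y ⇔ x < y)
  compare-images refl refl eq = eq

  irreflexive : ∀ z → t z < t z ⇔ z < z
  irreflexive z = mk⇔ (⊥-elim ∘ <-irrefl refl) (⊥-elim ∘ <-irrefl refl)

  t-order : ∀ x y → ¬ (x ≡ a × y ≡ a′) → ¬ (x ≡ a′ × y ≡ a) → t x < t y ⇔ x < y
  t-order x y _ _ with place x | place y
  t-order .a .a _ _ | at-a refl | at-a refl = irreflexive a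
  t-order .a .a′ h _ | at-a refl | at-a′ refl = ⊥-elim (h (refl , refl))
  t-order .a y _ _ | at-a refl | away y≢a y≢a′ =
    compare-images (transpose-right a′ a) (transpose-other a′ a y y≢a′ y≢a) (⇔-sym (above y≢a′))
  t-order .a′ .a _ h | at-a′ refl | at-a refl = ⊥-elim (h (refl , refl))
  t-order .a′ .a′ _ _ | at-a′ refl | at-a′ refl = irreflexive a′
  t-order .a′ y _ _ | at-a′ refl | away y≢a y≢a′ =
    compare-images (transpose-left a′ a) (transpose-other a′ a y y≢a′ y≢a) (above y≢a′)
  t-order x .a _ _ | away x≢a x≢a′ | at-a refl =
    compare-images (transpose-other a′ a x x≢a′ x≢a) (transpose-right a′ a) (⇔-sym (below x≢a))
  t-order x .a′ _ _ | away x≢a x≢a′ | at-a′ refl =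
    compare-images (transpose-other a′ a x x≢a′ x≢a) (transpose-left a′ a) (below x≢a)
  t-order x y _ _ | away x≢a x≢a′ | away y≢a y≢a′ =
    compare-images (transpose-other a′ a x x≢a′ x≢a) (transpose-other a′ a y y≢a′ y≢a) (⇔-id _)

-- A permutation of Fin (2 + k) sending 0 to p and 1 to q (for p ≢ q).
twoPoint : ∀ {k} (p q : Fin (suc (suc k))) → p ≢ q → Perm (suc (suc k))
twoPoint p q p≢q = ins p (transpose zero (punchOut p≢q))

twoPoint-1 : ∀ {k} (p q : Fin (suc (suc k))) (p≢q : p ≢ q) → twoPoint p q p≢q ⟨$⟩ʳ suc zero ≡ q
twoPoint-1 p q p≢q = ≡.trans (ins-suc p (transpose zero (punchOut p≢q)) zero)
  (≡.trans (≡.cong (punchIn p) (transpose-left zero (punchOut p≢q))) (punchIn-punchOut p≢q))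

module Sums {c ℓ} (R : CommutativeRing c ℓ) where

  open CommutativeRing R hiding (zero) renaming (refl to ≈-refl)
  open import Algebra.Properties.Semiring.Sum semiring
    using (sum; sum-syntax; sum-cong-≋; sum-remove; sum-replicate; sum-replicate-zero)
  open import Algebra.Properties.Monoid.Mult +-monoid using (×-assocˡ) renaming (_×_ to _×ᵣ_)
  open import Algebra.Properties.CommutativeSemigroup +-commutativeSemigroup using (interchange)
  open import Relation.Binary.Reasoning.Setoid setoid

  sumFin≡sum : ∀ m (f : Fin m → Carrier) → sumFin R m f ≡ sum f
  sumFin≡sum zero f = refl
  sumFin≡sum (suc m) f = ≡.cong (f zero +_) (sumFin≡sum m (f ∘ suc))

  natR≡× : ∀ k → natR R k ≡ k ×ᵣ 1#
  natR≡× zero = refl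
  natR≡× (suc k) = ≡.cong (1# +_) (natR≡× k)

  ∑-cong : ∀ m {f g : Fin m → Carrier} → (∀ j → f j ≈ g j) → sum f ≈ sum g
  ∑-cong m {f} {g} = sum-cong-≋ {m} {f} {g}

  [_] : Bool → Carrier
  [ true ] = 1#
  [ false ] = 0#

  𝟙 : ∀ {p} {A : Set p} → Dec A → Carrier
  𝟙 d = [ does d ]

  𝟙-⇔ : ∀ {p q} {A : Set p} {B : Set q} → A ⇔ B → (a? : Dec A) (b? : Dec B) → 𝟙 a? ≈ 𝟙 b?
  𝟙-⇔ A⇔B a? b? = reflexive (≡.cong [_] (does-⇔ A⇔B a? b?))

  𝟙-× : ∀ {p q} {A : Set p} {B : Set q} (a? : Dec A) (b? : Dec B) → 𝟙 (a? ×-dec b?) ≈ 𝟙 a? * 𝟙 b?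
  𝟙-× a? b? with does a?
  ... | true = sym (*-identityˡ _)
  ... | false = sym (zeroˡ _)

  complement : ∀ b x → [ b ] * x + [ not b ] * x ≈ x
  complement true x = trans (+-cong (*-identityˡ x) (zeroˡ x)) (+-identityʳ x)
  complement false x = trans (+-cong (zeroˡ x) (*-identityˡ x)) (+-identityˡ x)

  ∑-select : ∀ m (a : Fin m) (f : Fin m → Carrier) → ∑[ j < m ] (𝟙 (j ≟ a) * f j) ≈ f a
  ∑-select (suc m) a f = begin
    ∑[ j < suc m ] (𝟙 (j ≟ a) * f j)
      ≈⟨ sum-remove {i = a} (λ j → 𝟙 (j ≟ a) * f j) ⟩
    𝟙 (a ≟ a) * f a + ∑[ j < m ] (𝟙 (punchIn a j ≟ a) * f (punchIn a j))
      ≈⟨ +-cong (reflexive (≡.cong (λ b → [ b ] * f a) (dec-true (a ≟ a) refl)))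
                (∑-cong m (λ j → reflexive (≡.cong (λ b → [ b ] * f (punchIn a j))
                                                       (dec-false (punchIn a j ≟ a) (punchInᵢ≢i a j))))) ⟩
    1# * f a + ∑[ j < m ] (0# * f (punchIn a j))
      ≈⟨ +-cong (*-identityˡ (f a)) (trans (∑-cong m (λ j → zeroˡ _)) (sum-replicate-zero m)) ⟩
    f a + 0#
      ≈⟨ +-identityʳ (f a) ⟩
    f a ∎

  ∑ₗ : {A : Set} → List A → (A → Carrier) → Carrier
  ∑ₗ = sumList R

  ∑ₗ-cong : ∀ {A : Set} (xs : List A) {f g : A → Carrier} → (∀ a → f a ≈ g a) → ∑ₗ xs f ≈ ∑ₗ xs g
  ∑ₗ-cong [] eq = ≈-refl
  ∑ₗ-cong (x ∷ xs) eq = +-cong (eq x) (∑ₗ-cong xs eq)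

  ∑ₗ-zero : ∀ {A : Set} (xs : List A) → ∑ₗ xs (λ _ → 0#) ≈ 0#
  ∑ₗ-zero [] = ≈-refl
  ∑ₗ-zero (x ∷ xs) = trans (+-congˡ (∑ₗ-zero xs)) (+-identityˡ 0#)

  ∑ₗ-distrib-+ : ∀ {A : Set} (xs : List A) (f g : A → Carrier) →
    ∑ₗ xs (λ a → f a + g a) ≈ ∑ₗ xs f + ∑ₗ xs g
  ∑ₗ-distrib-+ [] f g = sym (+-identityˡ 0#)
  ∑ₗ-distrib-+ (x ∷ xs) f g =
    trans (+-congˡ (∑ₗ-distrib-+ xs f g)) (interchange (f x) (g x) (∑ₗ xs f) (∑ₗ xs g))

  *-distribˡ-∑ₗ : ∀ {A : Set} (xs : List A) y (f : A → Carrier) → y * ∑ₗ xs f ≈ ∑ₗ xs (λ a → y * f a)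
  *-distribˡ-∑ₗ [] y f = zeroʳ y
  *-distribˡ-∑ₗ (x ∷ xs) y f = trans (distribˡ y _ _) (+-congˡ (*-distribˡ-∑ₗ xs y f))

  ∑ₗ-comm : ∀ {A B : Set} (xs : List A) (ys : List B) (f : A → B → Carrier) →
    ∑ₗ xs (λ a → ∑ₗ ys (f a)) ≈ ∑ₗ ys (λ b → ∑ₗ xs (λ a → f a b))
  ∑ₗ-comm [] ys f = sym (∑ₗ-zero ys)
  ∑ₗ-comm (x ∷ xs) ys f =
    trans (+-congˡ (∑ₗ-comm xs ys f)) (sym (∑ₗ-distrib-+ ys (f x) _))

  ∑ₗ-++ : ∀ {A : Set} (xs ys : List A) f → ∑ₗ (xs ++ ys) f ≈ ∑ₗ xs f + ∑ₗ ys f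
  ∑ₗ-++ [] ys f = sym (+-identityˡ _)
  ∑ₗ-++ (x ∷ xs) ys f = trans (+-congˡ (∑ₗ-++ xs ys f)) (sym (+-assoc _ _ _))

  ∑ₗ-concatMap : ∀ {A B : Set} (g : A → List B) (xs : List A) f →
    ∑ₗ (concatMap g xs) f ≈ ∑ₗ xs (λ a → ∑ₗ (g a) f)
  ∑ₗ-concatMap g [] f = ≈-refl
  ∑ₗ-concatMap g (x ∷ xs) f = trans (∑ₗ-++ (g x) _ f) (+-congˡ (∑ₗ-concatMap g xs f))

  ∑ₗ-map : ∀ {A B : Set} (g : A → B) (xs : List A) f → ∑ₗ (map g xs) f ≈ ∑ₗ xs (f ∘ g)
  ∑ₗ-map g [] f = ≈-refl
  ∑ₗ-map g (x ∷ xs) f = +-congˡ (∑ₗ-map g xs f)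

  ∑ₗ-tabulate : ∀ {A : Set} m (g : Fin m → A) f → ∑ₗ (tabulate g) f ≈ ∑[ j < m ] f (g j)
  ∑ₗ-tabulate zero g f = ≈-refl
  ∑ₗ-tabulate (suc m) g f = +-congˡ (∑ₗ-tabulate m (g ∘ suc) f)

  ∑ₚ : ∀ n → (Perm n → Carrier) → Carrier
  ∑ₚ n = ∑ₗ (allPerms n)

  ∑ₚ-cong : ∀ n {F G : Perm n → Carrier} → (∀ σ → F σ ≈ G σ) → ∑ₚ n F ≈ ∑ₚ n G
  ∑ₚ-cong n = ∑ₗ-cong (allPerms n)

  -- 'allPerms' lists S_n only up to ≈ₚ, so reindexing requires summands that
  -- respect ≈ₚ.
  Extensional : ∀ {n} → (Perm n → Carrier) → Set ℓ
  Extensional F = ∀ {σ ρ} → σ ≈ₚ ρ → F σ ≈ F ρ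

  ∑ₚ-ins : ∀ n (F : Perm (suc n) → Carrier) → ∑ₚ (suc n) F ≈ ∑[ j < suc n ] ∑ₚ n (F ∘ ins j)
  ∑ₚ-ins n F = begin
    ∑ₗ (concatMap (λ j → map (ins j) (allPerms n)) (allFin (suc n))) F
      ≈⟨ ∑ₗ-concatMap (λ j → map (ins j) (allPerms n)) (allFin (suc n)) F ⟩
    ∑ₗ (allFin (suc n)) (λ j → ∑ₗ (map (ins j) (allPerms n)) F)
      ≈⟨ ∑ₗ-tabulate (suc n) (λ j → j) _ ⟩
    ∑[ j < suc n ] ∑ₗ (map (ins j) (allPerms n)) F
      ≈⟨ ∑-cong (suc n) (λ j → ∑ₗ-map (ins j) (allPerms n) F) ⟩
    ∑[ j < suc n ] ∑ₚ n (F ∘ ins j) ∎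

  ∑-select-∑ₚ : ∀ n (a : Fin (suc n)) (g : Fin (suc n) → Perm n → Carrier) →
    ∑[ j < suc n ] ∑ₚ n (λ π → 𝟙 (j ≟ a) * g j π) ≈ ∑ₚ n (g a)
  ∑-select-∑ₚ n a g = trans
    (∑-cong (suc n) (λ j → sym (*-distribˡ-∑ₗ (allPerms n) (𝟙 (j ≟ a)) (g j))))
    (∑-select (suc n) a (λ j → ∑ₚ n (g j)))

  ∑ₚ-fix₀ : ∀ n (a : Fin (suc n)) (F : Perm (suc n) → Carrier) →
    ∑ₚ (suc n) (λ σ → 𝟙 (σ ⟨$⟩ʳ zero ≟ a) * F σ) ≈ ∑ₚ n (F ∘ ins a)
  ∑ₚ-fix₀ n a F = trans (∑ₚ-ins n _) (∑-select-∑ₚ n a (λ j π → F (ins j π)))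

  ∑ₚ-∑-comm : ∀ n m (f : Perm n → Fin m → Carrier) →
    ∑ₚ n (λ σ → ∑[ i < m ] f σ i) ≈ ∑[ i < m ] ∑ₚ n (λ σ → f σ i)
  ∑ₚ-∑-comm n m f = begin
    ∑ₚ n (λ σ → ∑[ i < m ] f σ i)            ≈⟨ ∑ₚ-cong n (λ σ → sym (∑ₗ-tabulate m (λ i → i) (f σ))) ⟩
    ∑ₚ n (λ σ → ∑ₗ (allFin m) (f σ))         ≈⟨ ∑ₗ-comm (allPerms n) (allFin m) f ⟩
    ∑ₗ (allFin m) (λ i → ∑ₚ n (λ σ → f σ i)) ≈⟨ ∑ₗ-tabulate m (λ i → i) _ ⟩
    ∑[ i < m ] ∑ₚ n (λ σ → f σ i)            ∎

  δ : ∀ {n} → Perm n → Perm n → Carrier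
  δ u σ = 𝟙 (σ ≈ₚ? u)

  δ-ins : ∀ {n} (u : Perm (suc n)) j π → δ u (ins j π) ≈ 𝟙 (j ≟ u ⟨$⟩ʳ zero) * δ (remove zero u) π
  δ-ins u j π = trans (𝟙-⇔ (ins-≈ₚ j π u) (ins j π ≈ₚ? u) (j≟u₀ ×-dec π≈ₚ?u′)) (𝟙-× j≟u₀ π≈ₚ?u′)
    where
    j≟u₀ = j ≟ u ⟨$⟩ʳ zero
    π≈ₚ?u′ = π ≈ₚ? remove zero u

  -- Each permutation occurs exactly once in 'allPerms n', up to ≈ₚ.
  ∑ₚ-delta : ∀ n (u : Perm n) (G : Perm n → Carrier) → Extensional G → ∑ₚ n (λ σ → δ u σ * G σ) ≈ G u
  ∑ₚ-delta zero u G ext with id ≈ₚ? u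
  ... | yes id≈u = trans (+-identityʳ _) (trans (*-identityˡ _) (ext id≈u))
  ... | no id≉u = ⊥-elim (id≉u (λ ()))
  ∑ₚ-delta (suc n) u G ext = begin
    ∑ₚ (suc n) (λ σ → δ u σ * G σ)
      ≈⟨ ∑ₚ-ins n _ ⟩
    ∑[ j < suc n ] ∑ₚ n (λ π → δ u (ins j π) * G (ins j π))
      ≈⟨ ∑-cong (suc n) (λ j → ∑ₚ-cong n (λ π → trans (*-congʳ (δ-ins u j π)) (*-assoc _ _ (G (ins j π))))) ⟩
    ∑[ j < suc n ] ∑ₚ n (λ π → 𝟙 (j ≟ u₀) * (δ u′ π * G (ins j π)))
      ≈⟨ ∑-select-∑ₚ n u₀ (λ j π → δ u′ π * G (ins j π)) ⟩
    ∑ₚ n (λ π → δ u′ π * G (ins u₀ π))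
      ≈⟨ ∑ₚ-delta n u′ (G ∘ ins u₀) (ext ∘ ins-cong u₀) ⟩
    G (ins u₀ u′)
      ≈⟨ ext (insert-remove zero u) ⟩
    G u ∎
    where
    u₀ = u ⟨$⟩ʳ zero
    u′ = remove zero u

  ∑ₚ-one : ∀ n → ∑ₚ n (λ _ → 1#) ≈ natR R (n !)
  ∑ₚ-one zero = ≈-refl
  ∑ₚ-one (suc n) = begin
    ∑ₚ (suc n) (λ _ → 1#)            ≈⟨ ∑ₚ-ins n _ ⟩
    ∑[ j < suc n ] ∑ₚ n (λ _ → 1#)   ≈⟨ ∑-cong (suc n) (λ _ → ∑ₚ-one n) ⟩
    ∑[ j < suc n ] natR R (n !)      ≈⟨ sum-replicate (suc n) ⟩
    suc n ×ᵣ natR R (n !)            ≡⟨ ≡.cong (suc n ×ᵣ_) (natR≡× (n !)) ⟩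
    suc n ×ᵣ ((n !) ×ᵣ 1#)           ≈⟨ ×-assocˡ 1# (suc n) (n !) ⟩
    (suc n !) ×ᵣ 1#                  ≡⟨ ≡.sym (natR≡× (suc n !)) ⟩
    natR R (suc n !)                 ∎

  -- Reindexing along a bijection Φ of S_n with inverse Ψ: write each term as
  -- a δ-sum, swap the two sums, and move the bijection across the δ.
  module Reindex {n} (Φ Ψ : Perm n → Perm n)
    (Φ-cong : ∀ {σ ρ} → σ ≈ₚ ρ → Φ σ ≈ₚ Φ ρ) (Ψ-cong : ∀ {σ ρ} → σ ≈ₚ ρ → Ψ σ ≈ₚ Ψ ρ)
    (ΦΨ : ∀ σ → Φ (Ψ σ) ≈ₚ σ) (ΨΦ : ∀ σ → Ψ (Φ σ) ≈ₚ σ) where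

    δ-transpose : ∀ σ ρ → δ (Φ σ) ρ ≈ δ (Ψ ρ) σ
    δ-transpose σ ρ = 𝟙-⇔ (mk⇔
      (λ ρ≈Φσ k → ≡.trans (≡.sym (ΨΦ σ k)) (Ψ-cong (λ z → ≡.sym (ρ≈Φσ z)) k))
      (λ σ≈Ψρ k → ≡.trans (≡.sym (ΦΨ ρ k)) (Φ-cong (λ z → ≡.sym (σ≈Ψρ z)) k)))
      (ρ ≈ₚ? Φ σ) (σ ≈ₚ? Ψ ρ)

    reindex : (F : Perm n → Carrier) → Extensional F → ∑ₚ n (F ∘ Φ) ≈ ∑ₚ n F
    reindex F ext = begin
      ∑ₚ n (F ∘ Φ)
        ≈⟨ ∑ₚ-cong n (λ σ → sym (∑ₚ-delta n (Φ σ) F ext)) ⟩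
      ∑ₚ n (λ σ → ∑ₚ n (λ ρ → δ (Φ σ) ρ * F ρ))
        ≈⟨ ∑ₗ-comm (allPerms n) (allPerms n) _ ⟩
      ∑ₚ n (λ ρ → ∑ₚ n (λ σ → δ (Φ σ) ρ * F ρ))
        ≈⟨ ∑ₚ-cong n (λ ρ → ∑ₚ-cong n (λ σ → *-congʳ (δ-transpose σ ρ))) ⟩
      ∑ₚ n (λ ρ → ∑ₚ n (λ σ → δ (Ψ ρ) σ * F ρ))
        ≈⟨ ∑ₚ-cong n (λ ρ → ∑ₚ-delta n (Ψ ρ) (λ _ → F ρ) (λ _ → ≈-refl)) ⟩
      ∑ₚ n F ∎

  ∑ₚ-reindex : ∀ n (g h : Perm n) (F : Perm n → Carrier) → Extensional F →
    ∑ₚ n (λ ρ → F (g ∘ₚ ρ ∘ₚ h)) ≈ ∑ₚ n F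
  ∑ₚ-reindex n g h = reindex
    where
    open Reindex (λ ρ → g ∘ₚ ρ ∘ₚ h) (λ σ → flip g ∘ₚ σ ∘ₚ flip h)
      (λ e k → ≡.cong (h ⟨$⟩ʳ_) (e (g ⟨$⟩ʳ k)))
      (λ e k → ≡.cong (h ⟨$⟩ˡ_) (e (g ⟨$⟩ˡ k)))
      (λ σ k → ≡.trans (inverseʳ h) (≡.cong (σ ⟨$⟩ʳ_) (inverseˡ g)))
      (λ σ k → ≡.trans (inverseˡ h) (≡.cong (σ ⟨$⟩ʳ_) (inverseʳ g)))

  count₀₁ : ∀ k → ∑ₚ (suc (suc k)) (λ σ → 𝟙 (sends? σ zero zero (suc zero) (suc zero)))
                  ≈ natR R (k !)
  count₀₁ k = begin
    ∑ₚ (suc (suc k)) (λ σ → 𝟙 (sends? σ zero zero (suc zero) (suc zero)))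
      ≈⟨ ∑ₚ-cong (suc (suc k)) (λ σ → 𝟙-× (σ ⟨$⟩ʳ zero ≟ zero) (σ ⟨$⟩ʳ suc zero ≟ suc zero)) ⟩
    ∑ₚ (suc (suc k)) (λ σ → 𝟙 (σ ⟨$⟩ʳ zero ≟ zero) * 𝟙 (σ ⟨$⟩ʳ suc zero ≟ suc zero))
      ≈⟨ ∑ₚ-fix₀ (suc k) zero _ ⟩
    ∑ₚ (suc k) (λ π → 𝟙 (ins zero π ⟨$⟩ʳ suc zero ≟ suc zero))
      ≈⟨ ∑ₚ-cong (suc k) (λ π → trans (𝟙-⇔ (fixes-1 π) (ins zero π ⟨$⟩ʳ suc zero ≟ suc zero) (π ⟨$⟩ʳ zero ≟ zero))
                                       (sym (*-identityʳ _))) ⟩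
    ∑ₚ (suc k) (λ π → 𝟙 (π ⟨$⟩ʳ zero ≟ zero) * 1#)
      ≈⟨ ∑ₚ-fix₀ k zero _ ⟩
    ∑ₚ k (λ _ → 1#)
      ≈⟨ ∑ₚ-one k ⟩
    natR R (k !) ∎
    where
    fixes-1 : ∀ π → ins zero π ⟨$⟩ʳ suc zero ≡ suc zero ⇔ π ⟨$⟩ʳ zero ≡ zero
    fixes-1 π = mk⇔ (suc-injective ∘ ≡.trans (≡.sym (ins-suc zero π zero)))
                    (≡.trans (ins-suc zero π zero) ∘ ≡.cong suc)

  -- For p ≢ q and a ≢ b there are k! permutations of Fin (2+k) with p ↦ a and
  -- q ↦ b: conjugating by permutations sending 0, 1 to p, q and to a, b
  -- reduces this to 'count₀₁'.
  count : ∀ k {p q a b : Fin (suc (suc k))} → p ≢ q → a ≢ b →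
    ∑ₚ (suc (suc k)) (λ σ → 𝟙 (sends? σ p a q b)) ≈ natR R (k !)
  count k {p} {q} {a} {b} p≢q a≢b = begin
    ∑ₚ n F
      ≈⟨ sym (∑ₚ-reindex n (flip g) h F (λ {σ} {ρ} → F-ext {σ} {ρ})) ⟩
    ∑ₚ n (λ ρ → F (flip g ∘ₚ ρ ∘ₚ h))
      ≈⟨ ∑ₚ-cong n (λ ρ → 𝟙-⇔ (moved ρ) (sends? (flip g ∘ₚ ρ ∘ₚ h) p a q b)
                                          (sends? ρ zero zero (suc zero) (suc zero))) ⟩
    ∑ₚ n (λ ρ → 𝟙 (sends? ρ zero zero (suc zero) (suc zero)))
      ≈⟨ count₀₁ k ⟩
    natR R (k !) ∎
    where
    n = suc (suc k)
    g = twoPoint p q p≢q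
    h = twoPoint a b a≢b
    F : Perm n → Carrier
    F σ = 𝟙 (sends? σ p a q b)
    F-ext : Extensional F
    F-ext {σ} {ρ} e = 𝟙-⇔
      (mk⇔ (λ (σp , σq) → ≡.trans (≡.sym (e p)) σp , ≡.trans (≡.sym (e q)) σq)
           (λ (ρp , ρq) → ≡.trans (e p) ρp , ≡.trans (e q) ρq))
      (sends? σ p a q b) (sends? ρ p a q b)
    g⁻¹q≡1 : g ⟨$⟩ˡ q ≡ suc zero
    g⁻¹q≡1 = ⟨$⟩ˡ-of g (twoPoint-1 p q p≢q)
    moved : ∀ ρ → (h ⟨$⟩ʳ (ρ ⟨$⟩ʳ (g ⟨$⟩ˡ p)) ≡ a × h ⟨$⟩ʳ (ρ ⟨$⟩ʳ (g ⟨$⟩ˡ q)) ≡ b)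
                  ⇔ (ρ ⟨$⟩ʳ zero ≡ zero × ρ ⟨$⟩ʳ suc zero ≡ suc zero)
    moved ρ = (value-at ρ (inverseˡ g {zero}) ⇔-∘ ⟨$⟩ʳ-≡⇔ h refl)
          ×-⇔ (value-at ρ g⁻¹q≡1 ⇔-∘ ⟨$⟩ʳ-≡⇔ h (twoPoint-1 a b a≢b))
      where
      value-at : ∀ ρ {z z′ w : Fin n} → z ≡ z′ → (ρ ⟨$⟩ʳ z ≡ w ⇔ ρ ⟨$⟩ʳ z′ ≡ w)
      value-at ρ refl = ⇔-id _

module Coefficient {c ℓ} (R : CommutativeRing c ℓ) (k : ℕ) (τ : Perm (suc (suc k))) (i j : Fin (suc k)) where

  open CommutativeRing R hiding (zero) renaming (refl to ≈-refl)
  open Sums R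
  open import Relation.Binary.Reasoning.Setoid setoid
  open Adjacent i using (a; a′; a<a′; a≢a′; t; t-order)
  open Adjacent j using () renaming (a to v; a′ to v′; a<a′ to v<v′; a≢a′ to v≢v′)

  n : ℕ
  n = suc (suc k)

  -- σ ↦ s ∘ₚ σ swaps the entries of σ at the positions i and i+1.
  s : Perm n
  s = transpose a a′

  P E D : Perm n → Bool
  P σ = descent σ i
  E σ = descent (σ ∘ₚ τ) i
  D σ = descent (flip σ) j

  cτ : Bool
  cτ = descent τ j

  descent-swap : ∀ π → descent (s ∘ₚ π) i ≡ not (descent π i)
  descent-swap π = ≡.trans
    (≡.cong₂ (λ x y → does (π ⟨$⟩ʳ x <? π ⟨$⟩ʳ y)) (transpose-right a a′) (transpose-left a a′))
    (<?-flip (π ⟨$⟩ʳ a) (π ⟨$⟩ʳ a′) (a≢a′ ∘ ⟨$⟩ʳ-injective π))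

  hit? : (σ : Perm n) → Dec (σ ⟨$⟩ʳ a ≡ v × σ ⟨$⟩ʳ a′ ≡ v′)
  hit? σ = sends? σ a v a′ v′

  D-swap-miss : ∀ σ → ¬ (σ ⟨$⟩ʳ a ≡ v × σ ⟨$⟩ʳ a′ ≡ v′) → P σ ≡ false → D (s ∘ₚ σ) ≡ D σ
  D-swap-miss σ miss no-descent = does-⇔ (t-order (σ ⟨$⟩ˡ v′) (σ ⟨$⟩ˡ v) reversed-hit (miss ∘ hit))
    (_ <? _) (σ ⟨$⟩ˡ v′ <? σ ⟨$⟩ˡ v)
    where
    hit : σ ⟨$⟩ˡ v′ ≡ a′ × σ ⟨$⟩ˡ v ≡ a → σ ⟨$⟩ʳ a ≡ v × σ ⟨$⟩ʳ a′ ≡ v′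
    hit (e′ , e) = ⟨$⟩ʳ-of σ e , ⟨$⟩ʳ-of σ e′
    reversed-hit : ¬ (σ ⟨$⟩ˡ v′ ≡ a × σ ⟨$⟩ˡ v ≡ a′)
    reversed-hit (e′ , e) with ≡.trans (≡.sym no-descent) (dec-true (σ ⟨$⟩ʳ a′ <? σ ⟨$⟩ʳ a)
      (≡.subst₂ _<_ (≡.sym (⟨$⟩ʳ-of σ e)) (≡.sym (⟨$⟩ʳ-of σ e′)) v<v′))
    ... | ()

  module Hit (σ : Perm n) (σa≡v : σ ⟨$⟩ʳ a ≡ v) (σa′≡v′ : σ ⟨$⟩ʳ a′ ≡ v′) where
    σ⁻¹v≡a : σ ⟨$⟩ˡ v ≡ a
    σ⁻¹v≡a = ⟨$⟩ˡ-of σ σa≡v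
    σ⁻¹v′≡a′ : σ ⟨$⟩ˡ v′ ≡ a′
    σ⁻¹v′≡a′ = ⟨$⟩ˡ-of σ σa′≡v′

    P≡false : P σ ≡ false
    P≡false = ≡.trans (≡.cong₂ (λ x y → does (x <? y)) σa′≡v′ σa≡v) (dec-false (v′ <? v) (<-asym v<v′))
    D≡false : D σ ≡ false
    D≡false = ≡.trans (≡.cong₂ (λ x y → does (x <? y)) σ⁻¹v′≡a′ σ⁻¹v≡a) (dec-false (a′ <? a) (<-asym a<a′))
    D-swap≡true : D (s ∘ₚ σ) ≡ true
    D-swap≡true = ≡.trans
      (≡.cong₂ (λ x y → does (t x <? t y)) σ⁻¹v′≡a′ σ⁻¹v≡a)
      (≡.trans (≡.cong₂ (λ x y → does (x <? y)) (transpose-left a′ a) (transpose-right a′ a))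
               (dec-true (a <? a′) a<a′))
    E≡cτ : E σ ≡ cτ
    E≡cτ = ≡.cong₂ (λ x y → does (τ ⟨$⟩ʳ x <? τ ⟨$⟩ʳ y)) σa′≡v′ σa≡v

  -- Summing over S_n pair by pair: each pair {σ, s ∘ₚ σ} is represented by its
  -- member without a descent at i.
  pairing : (H : Perm n → Carrier) → Extensional H →
    ∑ₚ n H ≈ ∑ₚ n (λ σ → [ not (P σ) ] * (H σ + H (s ∘ₚ σ)))
  pairing H ext = begin
    ∑ₚ n H
      ≈⟨ ∑ₚ-cong n (λ σ → sym (complement (P σ) (H σ))) ⟩
    ∑ₚ n (λ σ → K σ + [ not (P σ) ] * H σ)
      ≈⟨ ∑ₗ-distrib-+ (allPerms n) K _ ⟩
    ∑ₚ n K + ∑ₚ n (λ σ → [ not (P σ) ] * H σ)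
      ≈⟨ +-congʳ (sym (∑ₚ-reindex n s id K K-ext)) ⟩
    ∑ₚ n (λ σ → K (s ∘ₚ σ ∘ₚ id)) + ∑ₚ n (λ σ → [ not (P σ) ] * H σ)
      ≈⟨ +-congʳ (∑ₚ-cong n swapped) ⟩
    ∑ₚ n (λ σ → [ not (P σ) ] * H (s ∘ₚ σ)) + ∑ₚ n (λ σ → [ not (P σ) ] * H σ)
      ≈⟨ +-comm _ _ ⟩
    ∑ₚ n (λ σ → [ not (P σ) ] * H σ) + ∑ₚ n (λ σ → [ not (P σ) ] * H (s ∘ₚ σ))
      ≈⟨ sym (∑ₗ-distrib-+ (allPerms n) _ _) ⟩
    ∑ₚ n (λ σ → [ not (P σ) ] * H σ + [ not (P σ) ] * H (s ∘ₚ σ))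
      ≈⟨ ∑ₚ-cong n (λ σ → sym (distribˡ _ _ _)) ⟩
    ∑ₚ n (λ σ → [ not (P σ) ] * (H σ + H (s ∘ₚ σ))) ∎
    where
    K : Perm n → Carrier
    K σ = [ P σ ] * H σ
    K-ext : Extensional K
    K-ext {σ} {ρ} e = *-cong (reflexive (≡.cong [_] (descent-cong σ ρ e i))) (ext e)
    swapped : ∀ σ → K (s ∘ₚ σ ∘ₚ id) ≈ [ not (P σ) ] * H (s ∘ₚ σ)
    swapped σ = *-cong (reflexive (≡.cong [_] (descent-swap σ))) (ext (λ _ → refl))

  G Q : Perm n → Carrier
  G σ = [ E σ ] * [ D σ ]
  Q σ = [ P σ ] * [ D σ ]

  G-ext : Extensional G
  G-ext {σ} {ρ} e = reflexive (≡.cong₂ (λ b d → [ b ] * [ d ])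
    (descent-cong (σ ∘ₚ τ) (ρ ∘ₚ τ) (≡.cong (τ ⟨$⟩ʳ_) ∘ e) i)
    (descent-cong (flip σ) (flip ρ) (⟨$⟩ˡ-cong {σ = σ} {ρ} e) j))

  Q-ext : Extensional Q
  Q-ext {σ} {ρ} e = reflexive (≡.cong₂ (λ b d → [ b ] * [ d ])
    (descent-cong σ ρ e i)
    (descent-cong (flip σ) (flip ρ) (⟨$⟩ˡ-cong {σ = σ} {ρ} e) j))

  -- The value on a pair {σ, s ∘ₚ σ} of a summand [e] [d] whose first factor
  -- flips along the pair; d′ is the second factor at s ∘ₚ σ.
  pairValue : Bool → Bool → Bool → Carrier
  pairValue e d d′ = [ e ] * [ d ] + [ not e ] * [ d′ ]

  G-pair : ∀ σ → G σ + G (s ∘ₚ σ) ≡ pairValue (E σ) (D σ) (D (s ∘ₚ σ))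
  G-pair σ = ≡.cong (λ b → G σ + [ b ] * [ D (s ∘ₚ σ) ]) (descent-swap (σ ∘ₚ τ))

  Q-pair : ∀ σ → Q σ + Q (s ∘ₚ σ) ≡ pairValue (P σ) (D σ) (D (s ∘ₚ σ))
  Q-pair σ = ≡.cong (λ b → Q σ + [ b ] * [ D (s ∘ₚ σ) ]) (descent-swap σ)

  pair-miss : ∀ p e d d′ → (p ≡ false → d′ ≡ d) →
    [ not p ] * pairValue e d d′ ≈ [ not p ] * pairValue p d d′
  pair-miss true e d d′ _ = trans (zeroˡ _) (sym (zeroˡ _))
  pair-miss false e d d′ constant with constant refl
  ... | refl = *-congˡ (trans (complement e [ d ]) (sym (complement false [ d ])))

  pair-hit : ∀ {p e d d′} → p ≡ false → e ≡ cτ → d ≡ false → d′ ≡ true →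
    [ not p ] * pairValue e d d′ + [ cτ ] * 1# ≈ [ not p ] * pairValue p d d′
  pair-hit refl refl refl refl = begin
    1# * ([ cτ ] * 0# + [ not cτ ] * 1#) + [ cτ ] * 1#
      ≈⟨ +-congʳ (trans (*-identityˡ _) (trans (+-congʳ (zeroʳ [ cτ ])) (+-identityˡ _))) ⟩
    [ not cτ ] * 1# + [ cτ ] * 1#
      ≈⟨ +-comm _ _ ⟩
    [ cτ ] * 1# + [ not cτ ] * 1#
      ≈⟨ complement cτ 1# ⟩
    1#
      ≈⟨ sym (trans (*-identityˡ _) (trans (+-congʳ (zeroˡ 0#)) (trans (+-identityˡ _) (*-identityˡ 1#)))) ⟩
    1# * (0# * 0# + 1# * 1#) ∎

  pointwise : ∀ σ → [ not (P σ) ] * (G σ + G (s ∘ₚ σ)) + [ cτ ] * 𝟙 (hit? σ)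
                  ≈ [ not (P σ) ] * (Q σ + Q (s ∘ₚ σ))
  pointwise σ with hit? σ
  ... | yes (σa≡v , σa′≡v′) = begin
    [ not (P σ) ] * (G σ + G (s ∘ₚ σ)) + [ cτ ] * 𝟙 (hit? σ)
      ≡⟨ ≡.cong₂ (λ x b → [ not (P σ) ] * x + [ cτ ] * [ b ]) (G-pair σ)
                 (dec-true (hit? σ) (σa≡v , σa′≡v′)) ⟩
    [ not (P σ) ] * pairValue (E σ) (D σ) (D (s ∘ₚ σ)) + [ cτ ] * 1#
      ≈⟨ pair-hit P≡false E≡cτ D≡false D-swap≡true ⟩
    [ not (P σ) ] * pairValue (P σ) (D σ) (D (s ∘ₚ σ))
      ≡⟨ ≡.cong ([ not (P σ) ] *_) (Q-pair σ) ⟨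
    [ not (P σ) ] * (Q σ + Q (s ∘ₚ σ)) ∎
    where open Hit σ σa≡v σa′≡v′
  ... | no miss = begin
    [ not (P σ) ] * (G σ + G (s ∘ₚ σ)) + [ cτ ] * 𝟙 (hit? σ)
      ≡⟨ ≡.cong (λ b → [ not (P σ) ] * (G σ + G (s ∘ₚ σ)) + [ cτ ] * [ b ]) (dec-false (hit? σ) miss) ⟩
    [ not (P σ) ] * (G σ + G (s ∘ₚ σ)) + [ cτ ] * 0#
      ≈⟨ trans (+-congˡ (zeroʳ [ cτ ])) (+-identityʳ _) ⟩
    [ not (P σ) ] * (G σ + G (s ∘ₚ σ))
      ≡⟨ ≡.cong ([ not (P σ) ] *_) (G-pair σ) ⟩
    [ not (P σ) ] * pairValue (E σ) (D σ) (D (s ∘ₚ σ))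
      ≈⟨ pair-miss (P σ) (E σ) (D σ) (D (s ∘ₚ σ)) (D-swap-miss σ miss) ⟩
    [ not (P σ) ] * pairValue (P σ) (D σ) (D (s ∘ₚ σ))
      ≡⟨ ≡.cong ([ not (P σ) ] *_) (Q-pair σ) ⟨
    [ not (P σ) ] * (Q σ + Q (s ∘ₚ σ)) ∎

  coefficient : ∑ₚ n G + [ cτ ] * natR R (k !) ≈ ∑ₚ n Q
  coefficient = begin
    ∑ₚ n G + [ cτ ] * natR R (k !)
      ≈⟨ +-cong (pairing G (λ {σ} {ρ} → G-ext {σ} {ρ})) (*-congˡ (sym (count k a≢a′ v≢v′))) ⟩
    ∑ₚ n (λ σ → [ not (P σ) ] * (G σ + G (s ∘ₚ σ))) + [ cτ ] * ∑ₚ n (𝟙 ∘ hit?)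
      ≈⟨ +-congˡ (*-distribˡ-∑ₗ (allPerms n) [ cτ ] (𝟙 ∘ hit?)) ⟩
    ∑ₚ n (λ σ → [ not (P σ) ] * (G σ + G (s ∘ₚ σ))) + ∑ₚ n (λ σ → [ cτ ] * 𝟙 (hit? σ))
      ≈⟨ sym (∑ₗ-distrib-+ (allPerms n) _ _) ⟩
    ∑ₚ n (λ σ → [ not (P σ) ] * (G σ + G (s ∘ₚ σ)) + [ cτ ] * 𝟙 (hit? σ))
      ≈⟨ ∑ₚ-cong n pointwise ⟩
    ∑ₚ n (λ σ → [ not (P σ) ] * (Q σ + Q (s ∘ₚ σ)))
      ≈⟨ sym (pairing Q (λ {σ} {ρ} → Q-ext {σ} {ρ})) ⟩
    ∑ₚ n Q ∎

module Expansion {c ℓ} (R : CommutativeRing c ℓ) (k : ℕ) (x : Fin (suc k) → CommutativeRing.Carrier R) where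

  open CommutativeRing R hiding (zero) renaming (refl to ≈-refl)
  open Sums R
  open import Algebra.Properties.Semiring.Sum semiring
    using (sum; sum-syntax; ∑-distrib-+; *-distribˡ-sum; *-distribʳ-sum)
  open import Algebra.Properties.CommutativeSemigroup *-commutativeSemigroup using (interchange)
  open import Algebra.Properties.Group +-group using (//-rightDividesʳ)
  open import Relation.Binary.Reasoning.Setoid setoid

  m n : ℕ
  m = suc k
  n = suc m

  K : Carrier
  K = natR R (k !)

  des : Perm n → Carrier
  des π = desX R x (π ⟨$⟩ʳ_)

  des-linear : ∀ π → des π ≈ ∑[ i < m ] ([ descent π i ] * x i)
  des-linear π = trans (reflexive (sumFin≡sum m (λ i → if descent π i then x i else 0#)))
                       (∑-cong m (λ i → if-indicator (descent π i) (x i)))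
    where
    if-indicator : ∀ b y → (if b then y else 0#) ≈ [ b ] * y
    if-indicator true y = sym (*-identityˡ y)
    if-indicator false y = sym (zeroˡ y)

  bilinear : ∀ (f g : Fin m → Carrier) →
    ∑[ i < m ] (f i * x i) * ∑[ j < m ] (g j * x j) ≈ ∑[ i < m ] ∑[ j < m ] ((x i * x j) * (f i * g j))
  bilinear f g = begin
    ∑[ i < m ] (f i * x i) * ∑[ j < m ] (g j * x j)
      ≈⟨ *-distribʳ-sum _ (λ i → f i * x i) ⟩
    ∑[ i < m ] ((f i * x i) * ∑[ j < m ] (g j * x j))
      ≈⟨ ∑-cong m (λ i → *-distribˡ-sum (f i * x i) (λ j → g j * x j)) ⟩
    ∑[ i < m ] ∑[ j < m ] ((f i * x i) * (g j * x j))
      ≈⟨ ∑-cong m (λ i → ∑-cong m (λ j →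
           trans (interchange (f i) (x i) (g j) (x j)) (*-comm (f i * g j) (x i * x j)))) ⟩
    ∑[ i < m ] ∑[ j < m ] ((x i * x j) * (f i * g j)) ∎

  N : Perm n → Fin m → Fin m → Carrier
  N τ i j = ∑ₚ n (λ σ → [ descent (σ ∘ₚ τ) i ] * [ descent (flip σ) j ])

  Pi-expand : ∀ τ → Pi R x τ ≈ ∑[ i < m ] ∑[ j < m ] ((x i * x j) * N τ i j)
  Pi-expand τ = begin
    Pi R x τ
      ≈⟨ ∑ₚ-cong n (λ σ → trans (*-cong (des-linear (σ ∘ₚ τ)) (des-linear (flip σ)))
                                (bilinear (λ i → [ descent (σ ∘ₚ τ) i ]) (λ j → [ descent (flip σ) j ]))) ⟩
    ∑ₚ n (λ σ → ∑[ i < m ] ∑[ j < m ] ((x i * x j) * summand σ i j))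
      ≈⟨ ∑ₚ-∑-comm n m (λ σ i → ∑[ j < m ] ((x i * x j) * summand σ i j)) ⟩
    ∑[ i < m ] ∑ₚ n (λ σ → ∑[ j < m ] ((x i * x j) * summand σ i j))
      ≈⟨ ∑-cong m (λ i → ∑ₚ-∑-comm n m (λ σ j → (x i * x j) * summand σ i j)) ⟩
    ∑[ i < m ] ∑[ j < m ] ∑ₚ n (λ σ → (x i * x j) * summand σ i j)
      ≈⟨ ∑-cong m (λ i → ∑-cong m (λ j →
           sym (*-distribˡ-∑ₗ (allPerms n) (x i * x j) (λ σ → summand σ i j)))) ⟩
    ∑[ i < m ] ∑[ j < m ] ((x i * x j) * N τ i j) ∎
    where
    summand : Perm n → Fin m → Fin m → Carrier
    summand σ i j = [ descent (σ ∘ₚ τ) i ] * [ descent (flip σ) j ]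

  correction : ∀ τ → des τ * (K * dn R x) ≈ ∑[ i < m ] ∑[ j < m ] ((x i * x j) * ([ descent τ j ] * K))
  correction τ = begin
    des τ * (K * dn R x)
      ≈⟨ *-comm _ _ ⟩
    (K * dn R x) * des τ
      ≈⟨ *-cong (trans (*-congˡ (reflexive (sumFin≡sum m x))) (*-distribˡ-sum K x)) (des-linear τ) ⟩
    ∑[ i < m ] (K * x i) * ∑[ j < m ] ([ descent τ j ] * x j)
      ≈⟨ bilinear (λ _ → K) (λ j → [ descent τ j ]) ⟩
    ∑[ i < m ] ∑[ j < m ] ((x i * x j) * (K * [ descent τ j ]))
      ≈⟨ ∑-cong m (λ i → ∑-cong m (λ j → *-congˡ {x i * x j} (*-comm K [ descent τ j ]))) ⟩
    ∑[ i < m ] ∑[ j < m ] ((x i * x j) * ([ descent τ j ] * K)) ∎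

  ∑∑-merge : ∀ (w u u′ : Fin m → Fin m → Carrier) →
    ∑[ i < m ] ∑[ j < m ] (w i j * u i j) + ∑[ i < m ] ∑[ j < m ] (w i j * u′ i j)
      ≈ ∑[ i < m ] ∑[ j < m ] (w i j * (u i j + u′ i j))
  ∑∑-merge w u u′ =
    trans (sym (∑-distrib-+ (λ i → ∑[ j < m ] (w i j * u i j)) (λ i → ∑[ j < m ] (w i j * u′ i j))))
    (∑-cong m (λ i → trans (sym (∑-distrib-+ (λ j → w i j * u i j) (λ j → w i j * u′ i j)))
                           (∑-cong m (λ j → sym (distribˡ (w i j) (u i j) (u′ i j))))))

  shifted : ∀ τ → Pi R x τ + des τ * (K * dn R x) ≈ Pi R x id
  shifted τ = begin
    Pi R x τ + des τ * (K * dn R x)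
      ≈⟨ +-cong (Pi-expand τ) (correction τ) ⟩
    ∑[ i < m ] ∑[ j < m ] ((x i * x j) * N τ i j) + ∑[ i < m ] ∑[ j < m ] ((x i * x j) * ([ descent τ j ] * K))
      ≈⟨ ∑∑-merge (λ i j → x i * x j) (N τ) (λ _ j → [ descent τ j ] * K) ⟩
    ∑[ i < m ] ∑[ j < m ] ((x i * x j) * (N τ i j + [ descent τ j ] * K))
      ≈⟨ ∑-cong m (λ i → ∑-cong m (λ j → *-congˡ {x i * x j} (Coefficient.coefficient R k τ i j))) ⟩
    ∑[ i < m ] ∑[ j < m ] ((x i * x j) * N id i j)
      ≈⟨ Pi-expand id ⟨
    Pi R x id ∎

  theorem : ∀ τ → Pi R x τ ≈ Pi R x id - des τ * (K * dn R x)
  theorem τ = trans (sym (//-rightDividesʳ (des τ * (K * dn R x)) (Pi R x τ))) (+-congʳ (shifted τ))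

-- Here n = suc m, and n ≥ 3 rules out m = 0 (the argument only needs n ≥ 2).
lemma3p2 : ∀ {c ℓ : Level} (R : CommutativeRing c ℓ) (m : ℕ) → 3 ≤ suc m →
    (x : Fin m → CommutativeRing.Carrier R) (τ : Permutation′ (suc m)) →
    CommutativeRing._≈_ R (Pi R x τ)
    (CommutativeRing._-_ R (Pi R x id)
    (CommutativeRing._*_ R (desX R x (τ ⟨$⟩ʳ_))
    (CommutativeRing._*_ R (natR R ((m ∸ 1) !)) (dn R x))))
lemma3p2 R (suc k) _ x τ = Expansion.theorem R k x τ
lemma3p2 R zero (s≤s ()) x τ
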